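{- Let $R$ be a finite $\{0,1\}$-free semiring. Let $e,f\in R$ such that $ef=fe=f$, $e^2=e$, and $f^2=f+f=f$. Then $e+f=f$.
   Context: A semiring is $(R,+,\cdot)$ with $(R,+)$ a commutative semigroup, $(R,\cdot)$ a semigroup and two-sided distributivity; no identities are required. $R$ is $\{0,1\}$-free if there is no subsemiring $T$ (non-empty subset closed under $+$ and $\cdot$) containing an additive identity $0$ of $T$ and a multiplicative identity $1\neq 0$ of $T$. -}

module Defs where

open import Level using (0ℓ)
open import Data.Nat using (ℕ)
open import Data.Fin using (Fin)
open import Data.Product using (Σ; _×_)
open import Relation.Nullary using (¬_)
open import Relation.Unary using (Pred; _∈_)
open import Relation.Binary.PropositionalEquality using (_≡_)
open import Function.Bundles using (_↔_)
open import Algebra.Core using (Op₂)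

-- A semiring in the paper's sense: no identities required.
-- (R,+) commutative semigroup, (R,·) semigroup, two-sided distributivity.
-- Equality on the carrier is propositional equality.
record SemiringNoId : Set₁ where
  infixl 6 _+_
  infixl 7 _·_
  field
    Carrier : Set
    _+_ : Op₂ Carrier
    _·_ : Op₂ Carrier
    +-assoc : ∀ x y z → (x + y) + z ≡ x + (y + z)
    +-comm  : ∀ x y → x + y ≡ y + x
    ·-assoc : ∀ x y z → (x · y) · z ≡ x · (y · z)
    distribˡ : ∀ x y z → x · (y + z) ≡ (x · y) + (x · z)
    distribʳ : ∀ x y z → (y + z) · x ≡ (y · x) + (z · x)

module _ (R : SemiringNoId) where
  open SemiringNoId R

  IsFinite : Set
  IsFinite = Σ ℕ λ n → Carrier ↔ Fin n

  -- T is a subsemiring: closed under + and · (non-emptiness is implied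
  -- below by containing z).
  IsClosed : Pred Carrier 0ℓ → Set
  IsClosed T = (∀ {x y} → x ∈ T → y ∈ T → (x + y) ∈ T)
             × (∀ {x y} → x ∈ T → y ∈ T → (x · y) ∈ T)

  Has01 : Pred Carrier 0ℓ → Set
  Has01 T = Σ Carrier λ z → Σ Carrier λ o →
              z ∈ T × o ∈ T
            × (∀ {x} → x ∈ T → (z + x ≡ x) × (x + z ≡ x))
            × (∀ {x} → x ∈ T → (o · x ≡ x) × (x · o ≡ x))
            × ¬ (o ≡ z)

  ZeroOneFree : Set₁
  ZeroOneFree = ¬ (Σ (Pred Carrier 0ℓ) λ T → IsClosed T × Has01 T)

-- Put g = e + f.  Then g is idempotent, f absorbs g (gf = fg = f)
-- and f + g = g, so (f, g) behaves like a pair "0, 1".  For any such pair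
-- (z, o) in any semiring the "corner"
--     C = { x | ox = x = xo,  z + x = x,  zx = z = xz }
-- is a subsemiring containing z and o in which z is an additive and o a
-- multiplicative identity.  A {0,1}-free semiring therefore cannot have
-- o ≠ z, i.e. ¬ ¬ (o ≡ z).  Finiteness gives decidable equality on the
-- carrier, which removes the double negation: g ≡ f.
module Submission where

open import Defs
open import Level using (0ℓ)
open import Data.Product using (_×_; _,_)
open import Relation.Nullary using (¬_)
open import Relation.Nullary.Decidable using (decidable-stable)
open import Relation.Unary using (Pred)
open import Relation.Binary.Definitions using (DecidableEquality)
open import Relation.Binary.PropositionalEquality
open import Function.Properties.Inverse using (↔⇒↣)
open import Data.Fin.Properties using (inj⇒≟)

finite⇒≟ : (R : SemiringNoId) → IsFinite R → DecidableEquality (SemiringNoId.Carrier R)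
finite⇒≟ R (n , R↔Fin) = inj⇒≟ (↔⇒↣ R↔Fin)

record IsZeroOnePair (R : SemiringNoId) (z o : SemiringNoId.Carrier R) : Set where
  open SemiringNoId R
  field
    z+z : z + z ≡ z
    z·z : z · z ≡ z
    o·o : o · o ≡ o
    o·z : o · z ≡ z
    z·o : z · o ≡ z
    z+o : z + o ≡ o

module Corner (R : SemiringNoId) {z o : SemiringNoId.Carrier R}
              (zo : IsZeroOnePair R z o) where
  open SemiringNoId R
  open IsZeroOnePair zo
  open ≡-Reasoning

  record InCorner (x : Carrier) : Set where
    field
      o·x : o · x ≡ x
      x·o : x · o ≡ x
      z+x : z + x ≡ x
      z·x : z · x ≡ z
      x·z : x · z ≡ z
  open InCorner

  C : Pred Carrier 0ℓ
  C = InCorner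

  z∈C : C z
  z∈C = record { o·x = o·z ; x·o = z·o ; z+x = z+z ; z·x = z·z ; x·z = z·z }

  o∈C : C o
  o∈C = record { o·x = o·o ; x·o = o·o ; z+x = z+o ; z·x = z·o ; x·z = o·z }

  +-closed : ∀ {x y} → C x → C y → C (x + y)
  +-closed {x} {y} cx cy = record
    { o·x = trans (distribˡ o x y) (cong₂ _+_ (o·x cx) (o·x cy))
    ; x·o = trans (distribʳ o x y) (cong₂ _+_ (x·o cx) (x·o cy))
    ; z+x = trans (sym (+-assoc z x y)) (cong (_+ y) (z+x cx))
    ; z·x = trans (distribˡ z x y) (trans (cong₂ _+_ (z·x cx) (z·x cy)) z+z)
    ; x·z = trans (distribʳ z x y) (trans (cong₂ _+_ (x·z cx) (x·z cy)) z+z)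
    }

  -- Products: associativity moves o and z onto the factor that absorbs
  -- them; for z + xy one writes z = zy and factors out y.
  ·-closed : ∀ {x y} → C x → C y → C (x · y)
  ·-closed {x} {y} cx cy = record
    { o·x = trans (sym (·-assoc o x y)) (cong (_· y) (o·x cx))
    ; x·o = trans (·-assoc x y o) (cong (x ·_) (x·o cy))
    ; z+x = begin
        z + x · y     ≡⟨ cong (_+ x · y) (sym (z·x cy)) ⟩
        z · y + x · y ≡⟨ sym (distribʳ y z x) ⟩
        (z + x) · y   ≡⟨ cong (_· y) (z+x cx) ⟩
        x · y         ∎
    ; z·x = trans (sym (·-assoc z x y)) (trans (cong (_· y) (z·x cx)) (z·x cy))
    ; x·z = trans (·-assoc x y z) (trans (cong (x ·_) (x·z cy)) (x·z cx))
    }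

  corner-has01 : ¬ (o ≡ z) → IsClosed R C × Has01 R C
  corner-has01 o≢z =
      (+-closed , ·-closed)
    , z , o , z∈C , o∈C
    , (λ cx → z+x cx , trans (+-comm _ z) (z+x cx))
    , (λ cx → o·x cx , x·o cx)
    , o≢z

zeroOnePair-collapse : (R : SemiringNoId) → ZeroOneFree R →
  ∀ {z o} → IsZeroOnePair R z o → ¬ ¬ (o ≡ z)
zeroOnePair-collapse R free zo o≢z = free (C , corner-has01 o≢z)
  where open Corner R zo

module AbsorbedIdempotent (R : SemiringNoId) where
  open SemiringNoId R
  open ≡-Reasoning

  sumPair : ∀ {e f} → e · f ≡ f → f · e ≡ f → e · e ≡ e →
    f · f ≡ f → f + f ≡ f → IsZeroOnePair R f (e + f)
  sumPair {e} {f} ef fe ee ff f+f = record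
    { z+z = f+f
    ; z·z = ff
    ; o·o = begin
        (e + f) · (e + f)                  ≡⟨ distribʳ (e + f) e f ⟩
        e · (e + f) + f · (e + f)          ≡⟨ cong₂ _+_ (distribˡ e e f) (distribˡ f e f) ⟩
        (e · e + e · f) + (f · e + f · f)  ≡⟨ cong₂ _+_ (cong₂ _+_ ee ef) (cong₂ _+_ fe ff) ⟩
        (e + f) + (f + f)                  ≡⟨ cong ((e + f) +_) f+f ⟩
        (e + f) + f                        ≡⟨ g+f≡g ⟩
        e + f                              ∎
    ; o·z = trans (distribʳ f e f) (trans (cong₂ _+_ ef ff) f+f)
    ; z·o = trans (distribˡ f e f) (trans (cong₂ _+_ fe ff) f+f)
    ; z+o = trans (+-comm f (e + f)) g+f≡g
    }
    where
    g+f≡g : (e + f) + f ≡ e + f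
    g+f≡g = trans (+-assoc e f f) (cong (e +_) f+f)

lemma5p14 : (R : SemiringNoId) → IsFinite R → ZeroOneFree R →
    let open SemiringNoId R in
    (e f : Carrier) → e · f ≡ f → f · e ≡ f → e · e ≡ e →
    f · f ≡ f → f + f ≡ f → e + f ≡ f
lemma5p14 R fin free e f ef fe ee ff f+f =
  decidable-stable (finite⇒≟ R fin (e + f) f)
    (zeroOnePair-collapse R free (sumPair ef fe ee ff f+f))
  where
  open SemiringNoId R
  open AbsorbedIdempotent R
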